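{- Fix an integer $b\ge 5$ and an integer $k$. Every $(b,k)$-overslack tree of height $h\ge 3$ has average node degree greater than $b-2$.
   Context: Leaf-oriented search trees store keys in leaves; the degree of an internal node is its number of non-nil child pointers and the degree of a leaf is its number of keys; a node of degree $b-x$ contains $x$ units of slack. Height is the depth of the leaves (root at depth 0). A $(b,k)$-overslack tree is a leaf-oriented search tree whose root has degree $k$, in which all leaves have the same depth, every internal node has between $2$ and $b$ child pointers, every leaf has between $0$ and $b$ keys, and for every internal node $u$ the children of $u$ contain a total of exactly $b$ slack. The average node degree is the sum of degrees of all nodes divided by the number of nodes (in the paper this quantity is denoted $\bar D(h,k)$). -}

module Defs where

open import Data.Nat using (ℕ; zero; suc; _+_; _*_; _∸_; _≤_; _<_)
open import Data.List using (List; []; _∷_; length; map)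
open import Data.Nat.ListAction using (sum)
open import Data.List.Relation.Unary.All using (All)
open import Data.Product using (_×_)
open import Relation.Binary.PropositionalEquality using (_≡_)

-- Leaf-oriented search tree shape: a leaf records its number of keys,
-- an internal node records its list of (non-nil) children.
data Tree : Set where
  leaf : ℕ → Tree
  node : List Tree → Tree

degree : Tree → ℕ
degree (leaf n)  = n
degree (node ts) = length ts

-- slack of a node w.r.t. parameter b (degrees are ≤ b in valid trees)
slack : ℕ → Tree → ℕ
slack b t = b ∸ degree t

data HasHeight : ℕ → Tree → Set where
  leafH : ∀ {n} → HasHeight 0 (leaf n)
  nodeH : ∀ {h ts} → All (HasHeight h) ts → HasHeight (suc h) (node ts)

data OverslackNodes (b : ℕ) : Tree → Set where
  leafO : ∀ {n} → n ≤ b → OverslackNodes b (leaf n)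
  nodeO : ∀ {ts} → 2 ≤ length ts → length ts ≤ b
        → sum (map (slack b) ts) ≡ b
        → All (OverslackNodes b) ts
        → OverslackNodes b (node ts)

OverslackTree : ℕ → ℕ → ℕ → Tree → Set
OverslackTree b k h t = OverslackNodes b t × degree t ≡ k × HasHeight h t

mutual
  sumDeg : Tree → ℕ
  sumDeg (leaf n)  = n
  sumDeg (node ts) = length ts + sumDegs ts

  sumDegs : List Tree → ℕ
  sumDegs []       = 0
  sumDegs (t ∷ ts) = sumDeg t + sumDegs ts

mutual
  size : Tree → ℕ
  size (leaf _)  = 1
  size (node ts) = suc (sizes ts)

  sizes : List Tree → ℕ
  sizes []       = 0
  sizes (t ∷ ts) = size t + sizes ts

-- Write M = b − 2 and call sumDeg t − M · size t the excess of t; the theorem says the excess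
-- is positive. Since the children of a node of degree L carry total slack b, their degrees sum
-- to (L − 1)(M + 2), and induction on the height shows that the excess of a tree of height h
-- whose root has degree d is exactly slope_h · (d − 2) + offset_h for integer coefficients given
-- by a linear recurrence. At height 3 they are M² + 3M + 5 and M(M − 2), both positive when
-- M ≥ 3, and the recurrence keeps them positive; as the root has degree at least 2, the excess
-- is at least offset_h > 0.
module Submission where

open import Defs
open import Data.Nat.Base as ℕ using (ℕ; zero; suc; s≤s)
import Data.Nat.Properties as ℕ
open import Data.List.Base using (List; []; _∷_; length; map)
open import Data.Nat.ListAction using (sum)
open import Data.List.Relation.Unary.All using (All; []; _∷_)
open import Data.Product.Base using (∃-syntax; _,_)
open import Algebra.Properties.CommutativeSemigroup ℕ.+-commutativeSemigroup using (interchange)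
open import Relation.Binary.PropositionalEquality

sumDegree : List Tree → ℕ
sumDegree ts = sum (map degree ts)

degree≤ : ∀ {b t} → OverslackNodes b t → degree t ℕ.≤ b
degree≤ (leafO n≤b)       = n≤b
degree≤ (nodeO _ L≤b _ _) = L≤b

2≤degree : ∀ {b h t} → HasHeight (suc h) t → OverslackNodes b t → 2 ℕ.≤ degree t
2≤degree (nodeH _) (nodeO 2≤L _ _ _) = 2≤L

sumDegree+slacks : ∀ {b ts} → All (OverslackNodes b) ts →
                   sumDegree ts ℕ.+ sum (map (slack b) ts) ≡ length ts ℕ.* b
sumDegree+slacks [] = refl
sumDegree+slacks {b} {t ∷ ts} (o ∷ os) = begin
  (degree t ℕ.+ sumDegree ts) ℕ.+ (slack b t ℕ.+ sum (map (slack b) ts))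
    ≡⟨ interchange (degree t) (sumDegree ts) (slack b t) _ ⟩
  (degree t ℕ.+ slack b t) ℕ.+ (sumDegree ts ℕ.+ sum (map (slack b) ts))
    ≡⟨ cong₂ ℕ._+_ (ℕ.m+[n∸m]≡n (degree≤ o)) (sumDegree+slacks os) ⟩
  b ℕ.+ length ts ℕ.* b ∎
  where open ≡-Reasoning

module Excess where

  open import Data.Integer.Base using (ℤ; +_; 0ℤ; 1ℤ; _+_; _-_; _*_)
  import Data.Integer.Properties as ℤ
  open import Data.Integer.Tactic.RingSolver using (solve-∀)

  2ℤ : ℤ
  2ℤ = + 2

  excess : ℤ → Tree → ℤ
  excess M t = + sumDeg t - M * + size t

  excesses : ℤ → List Tree → ℤ
  excesses M ts = + sumDegs ts - M * + sizes ts

  mutual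
    slope : ℤ → ℕ → ℤ
    slope M zero    = 1ℤ
    slope M (suc h) = 1ℤ + slope M h * M + offset M h

    offset : ℤ → ℕ → ℤ
    offset M zero    = 2ℤ - M
    offset M (suc h) = 2ℤ * offset M h + (slope M h - 1ℤ) * (M - 2ℤ)

  excess-node : ∀ M ts → excess M (node ts) ≡ + length ts + excesses M ts - M
  excess-node M ts = identity (+ length ts) (+ sumDegs ts) (+ sizes ts) M
    where
    identity : ∀ L D Z M → (L + D) - M * (1ℤ + Z) ≡ L + (D - M * Z) - M
    identity = solve-∀

  excesses-cons : ∀ M t ts → excesses M (t ∷ ts) ≡ excess M t + excesses M ts
  excesses-cons M t ts = identity (+ sumDeg t) (+ sumDegs ts) (+ size t) (+ sizes ts) M
    where
    identity : ∀ d D z Z M → (d + D) - M * (z + Z) ≡ (d - M * z) + (D - M * Z)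
    identity = solve-∀

  x+y≡z*y⇒x≡[z-1]*y : ∀ x y z → x + y ≡ z * y → x ≡ (z - 1ℤ) * y
  x+y≡z*y⇒x≡[z-1]*y x y z eq = begin
    x             ≡⟨ identity₁ x y ⟩
    (x + y) - y   ≡⟨ cong (_- y) eq ⟩
    z * y - y     ≡⟨ identity₂ y z ⟩
    (z - 1ℤ) * y  ∎
    where
    open ≡-Reasoning
    identity₁ : ∀ x y → x ≡ (x + y) - y
    identity₁ = solve-∀
    identity₂ : ∀ y z → z * y - y ≡ (z - 1ℤ) * y
    identity₂ = solve-∀

  sumDegree-children : ∀ {m ts} → sum (map (slack (2 ℕ.+ m)) ts) ≡ 2 ℕ.+ m →
                       All (OverslackNodes (2 ℕ.+ m)) ts →
                       + sumDegree ts ≡ (+ length ts - 1ℤ) * (2ℤ + + m)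
  sumDegree-children {m} {ts} slacks≡b os =
    x+y≡z*y⇒x≡[z-1]*y (+ sumDegree ts) (2ℤ + + m) (+ length ts) (begin
      + (sumDegree ts ℕ.+ (2 ℕ.+ m))              ≡⟨ cong (λ s → + (sumDegree ts ℕ.+ s)) slacks≡b ⟨
      + (sumDegree ts ℕ.+ sum (map (slack _) ts)) ≡⟨ cong +_ (sumDegree+slacks os) ⟩
      + (length ts ℕ.* (2 ℕ.+ m))                ≡⟨ ℤ.pos-* (length ts) (2 ℕ.+ m) ⟩
      + length ts * (2ℤ + + m)                   ∎)
    where open ≡-Reasoning

  mutual
    excess-formula : ∀ {m h t} → HasHeight h t → OverslackNodes (2 ℕ.+ m) t →
                     excess (+ m) t ≡ slope (+ m) h * (+ degree t - 2ℤ) + offset (+ m) h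
    excess-formula {m} {t = leaf n} leafH _ = identity (+ n) (+ m)
      where
      identity : ∀ n M → n - M * 1ℤ ≡ 1ℤ * (n - 2ℤ) + (2ℤ - M)
      identity = solve-∀
    excess-formula {m} {suc h} {node ts} (nodeH hs) (nodeO _ _ slacks≡b os) = begin
      excess M (node ts)
        ≡⟨ excess-node M ts ⟩
      L + excesses M ts - M
        ≡⟨ cong (λ e → L + e - M) (excesses-formula hs os) ⟩
      L + (α * (+ sumDegree ts - 2ℤ * L) + γ * L) - M
        ≡⟨ cong (λ D → L + (α * (D - 2ℤ * L) + γ * L) - M) (sumDegree-children slacks≡b os) ⟩
      L + (α * ((L - 1ℤ) * (2ℤ + M) - 2ℤ * L) + γ * L) - M
        ≡⟨ identity L M α γ ⟩
      slope M (suc h) * (L - 2ℤ) + offset M (suc h) ∎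
      where
      open ≡-Reasoning
      M = + m
      L = + length ts
      α = slope M h
      γ = offset M h
      identity : ∀ L M α γ →
                 L + (α * ((L - 1ℤ) * (2ℤ + M) - 2ℤ * L) + γ * L) - M
                 ≡ (1ℤ + α * M + γ) * (L - 2ℤ) + (2ℤ * γ + (α - 1ℤ) * (M - 2ℤ))
      identity = solve-∀

    excesses-formula : ∀ {m h ts} → All (HasHeight h) ts → All (OverslackNodes (2 ℕ.+ m)) ts →
                       excesses (+ m) ts
                       ≡ slope (+ m) h * (+ sumDegree ts - 2ℤ * + length ts) + offset (+ m) h * + length ts
    excesses-formula {m} {h} [] [] = identity (+ m) (slope (+ m) h) (offset (+ m) h)
      where
      identity : ∀ M α γ → 0ℤ - M * 0ℤ ≡ α * (0ℤ - 2ℤ * 0ℤ) + γ * 0ℤ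
      identity = solve-∀
    excesses-formula {m} {h} {t ∷ ts} (ht ∷ hs) (o ∷ os) = begin
      excesses M (t ∷ ts)
        ≡⟨ excesses-cons M t ts ⟩
      excess M t + excesses M ts
        ≡⟨ cong₂ _+_ (excess-formula ht o) (excesses-formula hs os) ⟩
      (α * (d - 2ℤ) + γ) + (α * (D - 2ℤ * L) + γ * L)
        ≡⟨ identity d D L α γ ⟩
      α * ((d + D) - 2ℤ * (1ℤ + L)) + γ * (1ℤ + L) ∎
      where
      open ≡-Reasoning
      M = + m
      α = slope M h
      γ = offset M h
      d = + degree t
      D = + sumDegree ts
      L = + length ts
      identity : ∀ d D L α γ →
                 (α * (d - 2ℤ) + γ) + (α * (D - 2ℤ * L) + γ * L)
                 ≡ α * ((d + D) - 2ℤ * (1ℤ + L)) + γ * (1ℤ + L)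
      identity = solve-∀

  record Coefficients (M : ℤ) (h : ℕ) (α γ : ℤ) : Set where
    constructor _,_
    field
      slope≡  : slope M h ≡ α
      offset≡ : offset M h ≡ γ

  coefficients-suc : ∀ {M h α γ α′ γ′} → Coefficients M h α γ →
                     1ℤ + α * M + γ ≡ α′ → 2ℤ * γ + (α - 1ℤ) * (M - 2ℤ) ≡ γ′ →
                     Coefficients M (suc h) α′ γ′
  coefficients-suc (refl , refl) refl refl = refl , refl

  coefficients-3 : ∀ M → Coefficients M 3 (+ 5 + + 3 * M + M * M) (M * (M - 2ℤ))
  coefficients-3 M =
    coefficients-suc (coefficients-suc (coefficients-suc (refl , refl)
      (slope₁ M) (offset₁ M)) (slope₂ M) (offset₂ M)) (slope₃ M) (offset₃ M)
    where
    slope₁ : ∀ M → 1ℤ + 1ℤ * M + (2ℤ - M) ≡ + 3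
    slope₁ = solve-∀
    offset₁ : ∀ M → 2ℤ * (2ℤ - M) + (1ℤ - 1ℤ) * (M - 2ℤ) ≡ + 4 - 2ℤ * M
    offset₁ = solve-∀
    slope₂ : ∀ M → 1ℤ + + 3 * M + (+ 4 - 2ℤ * M) ≡ + 5 + M
    slope₂ = solve-∀
    offset₂ : ∀ M → 2ℤ * (+ 4 - 2ℤ * M) + (+ 3 - 1ℤ) * (M - 2ℤ) ≡ + 4 - 2ℤ * M
    offset₂ = solve-∀
    slope₃ : ∀ M → 1ℤ + (+ 5 + M) * M + (+ 4 - 2ℤ * M) ≡ + 5 + + 3 * M + M * M
    slope₃ = solve-∀
    offset₃ : ∀ M → 2ℤ * (+ 4 - 2ℤ * M) + ((+ 5 + M) - 1ℤ) * (M - 2ℤ) ≡ M * (M - 2ℤ)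
    offset₃ = solve-∀

  coefficients-positive : ∀ c h → ∃[ p ] ∃[ q ]
                          Coefficients (+ (3 ℕ.+ c)) (3 ℕ.+ h) (+ suc p) (+ suc q)
  -- For M = 3 + c the values of coefficients-3 normalise to successors, so the witnesses are inferred.
  coefficients-positive c zero = _ , _ , coefficients-3 (+ (3 ℕ.+ c))
  coefficients-positive c (suc h) with coefficients-positive c h
  ... | p , q , coeffs =
    suc p ℕ.* (3 ℕ.+ c) ℕ.+ suc q , suc (2 ℕ.* q ℕ.+ p ℕ.* suc c) ,
    coefficients-suc coeffs refl (begin
      + (2 ℕ.* suc q) + + p * + suc c     ≡⟨ cong (λ x → + (2 ℕ.* suc q) + x) (ℤ.pos-* p (suc c)) ⟨
      + (2 ℕ.* suc q ℕ.+ p ℕ.* suc c)    ≡⟨ cong (λ n → + (n ℕ.+ p ℕ.* suc c)) (ℕ.*-suc 2 q) ⟩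
      + suc (suc (2 ℕ.* q ℕ.+ p ℕ.* suc c)) ∎)
    where open ≡-Reasoning

  excess-positive : ∀ {c h t} → HasHeight (3 ℕ.+ h) t → OverslackNodes (5 ℕ.+ c) t →
                    ∃[ r ] excess (+ (3 ℕ.+ c)) t ≡ + suc r
  excess-positive {c} {h} {t} height overslack
    with coefficients-positive c h | ℕ.m+[n∸m]≡n (2≤degree height overslack)
  ... | p , q , (slope≡ , offset≡) | 2+e≡d = suc p ℕ.* e ℕ.+ q , (begin
    excess M t
      ≡⟨ excess-formula height overslack ⟩
    slope M (3 ℕ.+ h) * (+ degree t - 2ℤ) + offset M (3 ℕ.+ h)
      ≡⟨ cong₂ (λ α γ → α * (+ degree t - 2ℤ) + γ) slope≡ offset≡ ⟩
    + suc p * (+ degree t - 2ℤ) + + suc q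
      -- + (2 + e) - 2ℤ reduces to + e
      ≡⟨ cong (λ d → + suc p * (+ d - 2ℤ) + + suc q) 2+e≡d ⟨
    + suc p * + e + + suc q
      ≡⟨ cong (λ x → x + + suc q) (ℤ.pos-* (suc p) e) ⟨
    + (suc p ℕ.* e ℕ.+ suc q)
      ≡⟨ cong +_ (ℕ.+-suc (suc p ℕ.* e) q) ⟩
    + suc (suc p ℕ.* e ℕ.+ q) ∎)
    where
    open ≡-Reasoning
    M = + (3 ℕ.+ c)
    e = degree t ℕ.∸ 2

  sumDeg≡+excess : ∀ m t r → excess (+ m) t ≡ + r → sumDeg t ≡ r ℕ.+ m ℕ.* size t
  sumDeg≡+excess m t r excess≡r = ℤ.+-injective (begin
    + sumDeg t                        ≡⟨ identity (+ sumDeg t) (+ m * + size t) ⟩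
    excess (+ m) t + + m * + size t   ≡⟨ cong₂ _+_ excess≡r (sym (ℤ.pos-* m (size t))) ⟩
    + r + + (m ℕ.* size t)            ∎)
    where
    open ≡-Reasoning
    identity : ∀ x y → x ≡ (x - y) + y
    identity = solve-∀

  m*size<sumDeg : ∀ {c h t} → HasHeight (3 ℕ.+ h) t → OverslackNodes (5 ℕ.+ c) t →
                  (3 ℕ.+ c) ℕ.* size t ℕ.< sumDeg t
  m*size<sumDeg {c} {t = t} height overslack with excess-positive height overslack
  ... | r , excess≡ =
    subst ((3 ℕ.+ c) ℕ.* size t ℕ.<_) (sym (sumDeg≡+excess (3 ℕ.+ c) t (suc r) excess≡))
          (ℕ.m<n+m _ {suc r} (s≤s ℕ.z≤n))

open import Data.Nat.Base using (_*_; _∸_; _≤_; _<_)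

lemma14 : (b k h : ℕ) (t : Tree) → 5 ≤ b → 3 ≤ h → OverslackTree b k h t
    → (b ∸ 2) * size t < sumDeg t
lemma14 _ _ _ t (s≤s (s≤s (s≤s (s≤s (s≤s _))))) (s≤s (s≤s (s≤s _))) (overslack , _ , height) =
  Excess.m*size<sumDeg height overslack
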